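{- Let $q$ be a prime power, let $\mu_{q+1}$ denote the group of all $(q+1)$-th roots of unity in $\mathbb{F}_{q^2}$, and pick an integer $v$ and a polynomial $D(X)\in\mathbb{F}_{q^2}[X]$ such that the function $c\mapsto c^v D(c)^{q-1}$ permutes $\mu_{q+1}$. Let $m$ be a nonnegative integer, and let $s_1,\dots,s_m$ and $t_1,\dots,t_m$ be positive integers such that for each $i$ we have $\gcd(s_i+1,q)=1$ and $(q+1)/\gcd(t_i,q+1)$ is coprime to $s_i+1$. Then: (1) If $r$ is a positive integer such that $\gcd(r,q-1)=1$ and $r\equiv v+\sum_{i=1}^m s_it_i\pmod{q+1}$, then $X^r B(X^{q-1})$ permutes $\mathbb{F}_{q^2}$, where $B(X):=D(X)\prod_{i=1}^m \sum_{j=0}^{s_i} X^{jt_i}$. (2) If $B(X)\in\mathbb{F}_{q^2}[X]$ satisfies $D(X)=B(X)\prod_{i=1}^m\sum_{j=0}^{s_i} X^{jt_i}$, and $r$ is a positive integer such that $\gcd(r,q-1)=1$ and $r\equiv v-\sum_{i=1}^m s_it_i\pmod{q+1}$, then $X^r B(X^{q-1})$ permutes $\mathbb{F}_{q^2}$.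
   Context: A polynomial $f(X)\in\mathbb{F}_{q^2}[X]$ is said to permute $\mathbb{F}_{q^2}$ (be a permutation polynomial) if the map $c\mapsto f(c)$ is a bijection $\mathbb{F}_{q^2}\to\mathbb{F}_{q^2}$. For $v$ possibly negative, $c^v$ is well defined on $\mu_{q+1}$ since its elements are nonzero. -}

module Defs where

open import Level using (0ℓ)
open import Data.Nat as ℕ using (ℕ; zero; suc; NonZero; ≢-nonZero)
open import Data.Nat.GCD using (gcd; gcd[m,n]≢0)
open import Data.Nat.DivMod using (_/_)
open import Data.Nat.Primality using (Prime)
open import Data.Integer as ℤ using (ℤ; +_; -[1+_])
open import Data.Fin using (Fin)
open import Data.List using (List; []; _∷_; map; replicate; _++_; foldr; upTo)
open import Data.Product using (Σ; ∃; _×_; _,_)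
open import Data.Sum using (inj₂)
open import Relation.Binary.PropositionalEquality using (_≡_; _≢_)
open import Relation.Nullary using (¬_)
open import Algebra.Structures using (IsCommutativeRing)
open import Function.Bundles using (_↔_)
open import Function.Definitions using (Injective; Surjective)

IsPrimePower : ℕ → Set
IsPrimePower q = Σ ℕ λ p → Σ ℕ λ k → Prime p × (k ℕ.≥ 1) × (q ≡ p ℕ.^ k)

-- A finite field with exactly n elements (equality is propositional).
-- inv is a total inverse, with inv 0 = 0 (only used on nonzero elements).

record FiniteField (n : ℕ) : Set₁ where
  field
    Carrier  : Set
    _+_ _*_  : Carrier → Carrier → Carrier
    -_       : Carrier → Carrier
    0# 1#    : Carrier
    inv      : Carrier → Carrier
    isCommutativeRing : IsCommutativeRing _≡_ _+_ _*_ -_ 0# 1#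
    0≢1      : 0# ≢ 1#
    inv-r    : ∀ x → x ≢ 0# → x * inv x ≡ 1#
    inv-0    : inv 0# ≡ 0#
    card     : Carrier ↔ Fin n

  infixl 6 _+_
  infixl 7 _*_

  _^_ : Carrier → ℕ → Carrier
  x ^ zero  = 1#
  x ^ suc k = x * (x ^ k)

  -- integer powers (meaningful for nonzero x)
  _^ℤ_ : Carrier → ℤ → Carrier
  x ^ℤ (+ k)      = x ^ k
  x ^ℤ (-[1+ k ]) = inv x ^ suc k

  -- Polynomials as coefficient lists, lowest degree first.

  Poly : Set
  Poly = List Carrier

  eval : Poly → Carrier → Carrier
  eval []       x = 0#
  eval (a ∷ as) x = a + x * eval as x

  coeff : Poly → ℕ → Carrier
  coeff []       _       = 0#
  coeff (a ∷ as) zero    = a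
  coeff (a ∷ as) (suc k) = coeff as k

  _≈ₚ_ : Poly → Poly → Set
  f ≈ₚ g = ∀ k → coeff f k ≡ coeff g k

  _+ₚ_ : Poly → Poly → Poly
  []       +ₚ g        = g
  (a ∷ f)  +ₚ []       = a ∷ f
  (a ∷ f)  +ₚ (b ∷ g)  = (a + b) ∷ (f +ₚ g)

  _*ₚ_ : Poly → Poly → Poly
  []      *ₚ g = []
  (a ∷ f) *ₚ g = map (a *_) g +ₚ (0# ∷ (f *ₚ g))

  monomial : ℕ → Poly
  monomial k = replicate k 0# ++ (1# ∷ [])

  geomPoly : ℕ → ℕ → Poly
  geomPoly s t = foldr (λ j acc → monomial (j ℕ.* t) +ₚ acc) [] (upTo (suc s))

  prodGeom : (m : ℕ) → (Fin m → ℕ) → (Fin m → ℕ) → Poly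
  prodGeom zero    s t = 1# ∷ []
  prodGeom (suc m) s t =
    geomPoly (s Fin.zero) (t Fin.zero) *ₚ prodGeom m (λ i → s (Fin.suc i)) (λ i → t (Fin.suc i))
    where import Data.Fin as Fin

  μ : ℕ → Carrier → Set
  μ k c = c ^ k ≡ 1#

  PermutesMu : ℕ → (Carrier → Carrier) → Set
  PermutesMu k f =
    (∀ c → μ k c → μ k (f c))
    × (∀ c d → μ k c → μ k d → f c ≡ f d → c ≡ d)
    × (∀ d → μ k d → ∃ λ c → μ k c × (f c ≡ d))

  Permutes : (Carrier → Carrier) → Set
  Permutes f = Injective _≡_ _≡_ f × Surjective _≡_ _≡_ f

quotGcd : ℕ → ℕ → ℕ
quotGcd q t = (suc q / gcd t (suc q))
  {{≢-nonZero (gcd[m,n]≢0 t (suc q) (inj₂ λ ()))}}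

sumFin : (m : ℕ) → (Fin m → ℕ) → ℕ
sumFin zero    a = 0
sumFin (suc m) a = a Fin.zero ℕ.+ sumFin m (λ i → a (Fin.suc i))
  where import Data.Fin as Fin

-- For c ∈ μ_{q+1} and w = c^t, the Frobenius x ↦ x^q inverts w, so it turns a = 1 + w + ⋯ + w^s into
-- 1 + w⁻¹ + ⋯ + w^{-s} = w^{-s} a; hence c^{st} a^{q-1} = 1 as soon as a ≠ 0. And a ≠ 0: otherwise
-- w^{s+1} = 1, which together with w^{(q+1)/gcd(t,q+1)} = 1 and the coprimality hypothesis gives w = 1,
-- so a = (s+1)·1, which is nonzero as s+1 is prime to the characteristic. Multiplying over i, the map
-- c ↦ c^r B(c)^{q-1} agrees on μ_{q+1} with c ↦ c^v D(c)^{q-1} in both (1) and (2), so it permutes μ_{q+1}.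
-- Finally x^r B(x^{q-1}) permutes F_{q²}: its (q-1)-th power is g(x^{q-1}) for that map g, x ↦ x^{q-1} sends
-- the nonzero elements into μ_{q+1}, and gcd(r, q-1) = 1 recovers x from x^{q-1} and x^r.

module Submission where

open import Level using (0ℓ)
open import Function.Base using (_∘_; id)
open import Function.Definitions using (Injective; Surjective)
open import Function.Bundles using (Inverse; Injection)
open import Function.Properties.Inverse using (↔⇒↣)
open import Relation.Binary.PropositionalEquality
open import Relation.Nullary using (¬_; Dec; yes; no; contradiction)
import Relation.Nullary.Decidable as Dec
open import Data.Empty using (⊥-elim)
open import Data.Sum using (inj₁; inj₂)
open import Data.Product using (Σ; ∃; _×_; _,_)
open import Data.List using ([]; _∷_)
import Data.List as List
open import Data.Fin as Fin using (Fin; punchIn; punchOut)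
import Data.Fin.Properties as Fin
open import Data.Fin.Permutation using (Permutation; permutation; _⟨$⟩ʳ_)

open import Data.Nat as ℕ using (ℕ; zero; suc; _≤_; _<_; _∸_; _!; z≤n; s≤s)
import Data.Nat.Properties as ℕ
open import Data.Nat.Properties using (_!*_!≢0)
open import Data.Nat.Divisibility as ℕ∣ using (divides)
open import Data.Nat.DivMod using (m/n*n≡m; _/_; *-/-assoc)
open import Data.Nat.GCD using (module Bézout; gcd; gcd[m,n]≢0; gcd[m,n]∣m; gcd[m,n]∣n)
open import Data.Nat.Coprimality using (Coprime; coprime-Bézout)
open import Data.Nat.Primality using (Prime; euclidsLemma; prime⇒nonZero; prime⇒nonTrivial)
open import Data.Nat.Combinatorics using (_C_; nCn≡1; k![n∸k]!∣n!)
open import Data.Nat.Combinatorics.Specification using (nCk≡n!/k![n-k]!)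
import Data.Nat.Solver as ℕSolver
import Data.Integer as ℤ
import Data.Integer.Properties as ℤ
open import Data.Integer.Divisibility as ℤ∣ using (_∣_)
import Data.Integer.Solver as ℤSolver

open import Algebra.Bundles using (CommutativeRing)
import Algebra.Properties.CommutativeSemigroup as CommutativeSemigroupProperties
import Algebra.Properties.Group as GroupProperties
import Algebra.Properties.CommutativeMonoid.Sum as CommutativeMonoidSum
import Algebra.Properties.Semiring.Mult as SemiringMult
import Algebra.Properties.CommutativeSemiring.Exp as CommutativeSemiringExp
import Algebra.Properties.CommutativeSemiring.Binomial as CommutativeSemiringBinomial
import Algebra.Solver.Ring.NaturalCoefficients.Default as NaturalCoefficientsSolver

open import Defs

prime∤! : ∀ {p} → Prime p → ∀ j → j < p → ¬ p ℕ∣.∣ j !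
prime∤! p-prime zero    _   p∣1  = ℕ.nonTrivial⇒≢1 {{prime⇒nonTrivial p-prime}} (ℕ∣.∣1⇒≡1 p∣1)
prime∤! p-prime (suc j) j<p p∣j! with euclidsLemma (suc j) (j !) p-prime p∣j!
... | inj₁ p∣1+j = ℕ∣.>⇒∤ j<p p∣1+j
... | inj₂ p∣j!  = prime∤! p-prime j (ℕ.<-trans (ℕ.n<1+n j) j<p) p∣j!

n∣n! : ∀ n → .{{ℕ.NonZero n}} → n ℕ∣.∣ n !
n∣n! (suc n) = ℕ∣.∣m⇒∣m*n (n !) ℕ∣.∣-refl

prime∣C : ∀ {p k} → Prime p → 0 < k → k < p → p ℕ∣.∣ p C k
prime∣C {p} {k} p-prime 0<k k<p with euclidsLemma (p C k) (k ! ℕ.* (p ∸ k) !) p-prime p∣C*k!*[p∸k]!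
  where
  C*k!*[p∸k]!≡p! : (p C k) ℕ.* (k ! ℕ.* (p ∸ k) !) ≡ p !
  C*k!*[p∸k]!≡p! = trans (cong (ℕ._* (k ! ℕ.* (p ∸ k) !)) (nCk≡n!/k![n-k]! (ℕ.<⇒≤ k<p)))
                         (m/n*n≡m {{k !* (p ∸ k) !≢0}} (k![n∸k]!∣n! (ℕ.<⇒≤ k<p)))
  p∣C*k!*[p∸k]! : p ℕ∣.∣ (p C k) ℕ.* (k ! ℕ.* (p ∸ k) !)
  p∣C*k!*[p∸k]! = subst (p ℕ∣.∣_) (sym C*k!*[p∸k]!≡p!) (n∣n! p {{prime⇒nonZero p-prime}})
... | inj₁ p∣C = p∣C
... | inj₂ p∣k!*[p∸k]! with euclidsLemma (k !) ((p ∸ k) !) p-prime p∣k!*[p∸k]!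
...   | inj₁ p∣k!     = ⊥-elim (prime∤! p-prime k k<p p∣k!)
...   | inj₂ p∣[p∸k]! = ⊥-elim (prime∤! p-prime (p ∸ k) (ℕ.∸-monoʳ-< 0<k (ℕ.<⇒≤ k<p)) p∣[p∸k]!)

Fin-injective⇒surjective : ∀ {k} (h : Fin k → Fin k) → Injective _≡_ _≡_ h → ∀ y → ∃ λ x → h x ≡ y
Fin-injective⇒surjective {suc k} h h-inj y with Fin.any? (λ x → h x Fin.≟ y)
... | yes hit = hit
... | no miss = ⊥-elim (ℕ.<-irrefl refl (Fin.injective⇒≤ h′-inj))
  where
  h′ : Fin (suc k) → Fin k
  h′ x = punchOut {i = y} {j = h x} (λ y≡hx → miss (x , sym y≡hx))
  h′-inj : Injective _≡_ _≡_ h′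
  h′-inj {a} {b} e = h-inj (Fin.punchOut-injective (λ y≡ha → miss (a , sym y≡ha)) (λ y≡hb → miss (b , sym y≡hb)) e)

-- P is an ideal of ℕ, so Bézout puts gcd a b = 1 into it.
coprime-closure : ∀ {ℓ} (P : ℕ → Set ℓ) → (∀ x a → P a → P (x ℕ.* a)) → (∀ u v → P (u ℕ.+ v) → P v → P u) →
                  ∀ {a b} → Coprime a b → P a → P b → P 1
coprime-closure P multiple difference a⊥b Pa Pb with coprime-Bézout a⊥b
... | Bézout.+- x y 1+yb≡xa = difference 1 _ (subst P (sym 1+yb≡xa) (multiple x _ Pa)) (multiple y _ Pb)
... | Bézout.-+ x y 1+xa≡yb = difference 1 _ (subst P (sym 1+xa≡yb) (multiple y _ Pb)) (multiple x _ Pa)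

m∣m^n : ∀ m {n} → 1 ≤ n → m ℕ∣.∣ m ℕ.^ n
m∣m^n m {suc n} _ = ℕ∣.m∣m*n (m ℕ.^ n)

coprime-∣ʳ : ∀ {m n d} → Coprime m n → d ℕ∣.∣ n → Coprime m d
coprime-∣ʳ m⊥n d∣n (i∣m , i∣d) = m⊥n (i∣m , ℕ∣.∣-trans i∣d d∣n)

[1+q]∣t*quotGcd : ∀ q t → suc q ℕ∣.∣ t ℕ.* quotGcd q t
[1+q]∣t*quotGcd q t = divides (t / g) (begin
  t ℕ.* (suc q / g)   ≡⟨ sym (*-/-assoc t (gcd[m,n]∣n t (suc q))) ⟩
  t ℕ.* suc q / g     ≡⟨ cong (_/ g) (ℕ.*-comm t (suc q)) ⟩
  suc q ℕ.* t / g     ≡⟨ *-/-assoc (suc q) (gcd[m,n]∣m t (suc q)) ⟩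
  suc q ℕ.* (t / g)   ≡⟨ ℕ.*-comm (suc q) (t / g) ⟩
  (t / g) ℕ.* suc q   ∎)
  where
  open ≡-Reasoning
  g : ℕ
  g = gcd t (suc q)
  instance
    g≢0 : ℕ.NonZero g
    g≢0 = ℕ.≢-nonZero (gcd[m,n]≢0 t (suc q) (inj₂ λ ()))

primePower≥2 : ∀ {q} → IsPrimePower q → 2 ≤ q
primePower≥2 (p , k , p-prime , 1≤k , refl) =
  ℕ.≤-trans p≥2 (ℕ.≤-trans (ℕ.≤-reflexive (sym (ℕ.*-identityʳ p))) (ℕ.^-monoʳ-≤ p 1≤k))
  where
  instance
    p≢0 : ℕ.NonZero p
    p≢0 = prime⇒nonZero p-prime
  p≥2 : 2 ≤ p
  p≥2 = ℕ.nonTrivial⇒n>1 p {{prime⇒nonTrivial p-prime}}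

module FiniteFieldProperties {n : ℕ} (F : FiniteField n) where

  open FiniteField F public
  open ≡-Reasoning

  ring : CommutativeRing 0ℓ 0ℓ
  ring = record { isCommutativeRing = isCommutativeRing }

  open CommutativeRing ring public
    using ( +-assoc; +-comm; +-identityˡ; +-identityʳ; -‿inverseˡ; -‿inverseʳ
          ; *-assoc; *-comm; *-identityˡ; *-identityʳ; zeroˡ; zeroʳ; distribˡ
          ; *-commutativeMonoid; +-commutativeMonoid; semiring; commutativeSemiring )
  open CommutativeSemigroupProperties (CommutativeRing.*-commutativeSemigroup ring) public
    using (interchange; x∙yz≈y∙xz; xy∙z≈xz∙y)
  open GroupProperties (CommutativeRing.+-group ring)
    using () renaming (identityʳ-unique to +-identityʳ-unique)

  index : Carrier → Fin n
  index = Inverse.to card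

  element : Fin n → Carrier
  element = Inverse.from card

  index-element : ∀ i → index (element i) ≡ i
  index-element = Inverse.strictlyInverseˡ card

  element-index : ∀ x → element (index x) ≡ x
  element-index = Inverse.strictlyInverseʳ card

  index-injective : Injective _≡_ _≡_ index
  index-injective = Injection.injective (↔⇒↣ card)

  element-injective : Injective _≡_ _≡_ element
  element-injective {i} {j} eᵢ≡eⱼ = trans (sym (index-element i)) (trans (cong index eᵢ≡eⱼ) (index-element j))

  infix 4 _≟_
  _≟_ : (x y : Carrier) → Dec (x ≡ y)
  x ≟ y = Dec.map′ index-injective (cong index) (index x Fin.≟ index y)

  1≢0 : 1# ≢ 0#
  1≢0 = 0≢1 ∘ sym

  inv-l : ∀ x → x ≢ 0# → inv x * x ≡ 1#
  inv-l x x≢0 = trans (*-comm (inv x) x) (inv-r x x≢0)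

  *-cancelˡ : ∀ {x y z} → x ≢ 0# → x * y ≡ x * z → y ≡ z
  *-cancelˡ {x} {y} {z} x≢0 xy≡xz = begin
    y                ≡⟨ sym (*-identityˡ y) ⟩
    1# * y           ≡⟨ cong (_* y) (sym (inv-l x x≢0)) ⟩
    (inv x * x) * y  ≡⟨ *-assoc (inv x) x y ⟩
    inv x * (x * y)  ≡⟨ cong (inv x *_) xy≡xz ⟩
    inv x * (x * z)  ≡⟨ sym (*-assoc (inv x) x z) ⟩
    (inv x * x) * z  ≡⟨ cong (_* z) (inv-l x x≢0) ⟩
    1# * z           ≡⟨ *-identityˡ z ⟩
    z                ∎

  *-cancelʳ : ∀ {x y z} → x ≢ 0# → y * x ≡ z * x → y ≡ z
  *-cancelʳ {x} {y} {z} x≢0 yx≡zx = *-cancelˡ x≢0 (trans (*-comm x y) (trans yx≡zx (*-comm z x)))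

  x*y≢0 : ∀ {x y} → x ≢ 0# → y ≢ 0# → x * y ≢ 0#
  x*y≢0 {x} x≢0 y≢0 xy≡0 = y≢0 (*-cancelˡ x≢0 (trans xy≡0 (sym (zeroʳ x))))

  module Exp = CommutativeSemiringExp commutativeSemiring

  ^≡Exp^ : ∀ x k → x ^ k ≡ x Exp.^ k
  ^≡Exp^ x zero    = refl
  ^≡Exp^ x (suc k) = cong (x *_) (^≡Exp^ x k)

  ^-homo-* : ∀ x a b → x ^ (a ℕ.+ b) ≡ x ^ a * x ^ b
  ^-homo-* x a b = begin
    x ^ (a ℕ.+ b)            ≡⟨ ^≡Exp^ x (a ℕ.+ b) ⟩
    x Exp.^ (a ℕ.+ b)        ≡⟨ Exp.^-homo-* x a b ⟩
    x Exp.^ a * x Exp.^ b    ≡⟨ sym (cong₂ _*_ (^≡Exp^ x a) (^≡Exp^ x b)) ⟩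
    x ^ a * x ^ b            ∎

  ^-assocʳ : ∀ x a b → (x ^ a) ^ b ≡ x ^ (a ℕ.* b)
  ^-assocʳ x a b = begin
    (x ^ a) ^ b              ≡⟨ trans (cong (_^ b) (^≡Exp^ x a)) (^≡Exp^ _ b) ⟩
    (x Exp.^ a) Exp.^ b      ≡⟨ Exp.^-assocʳ x a b ⟩
    x Exp.^ (a ℕ.* b)        ≡⟨ sym (^≡Exp^ x (a ℕ.* b)) ⟩
    x ^ (a ℕ.* b)            ∎

  ^-distrib-* : ∀ x y a → (x * y) ^ a ≡ x ^ a * y ^ a
  ^-distrib-* x y a = begin
    (x * y) ^ a              ≡⟨ ^≡Exp^ (x * y) a ⟩
    (x * y) Exp.^ a          ≡⟨ Exp.^-distrib-* x y a ⟩
    x Exp.^ a * y Exp.^ a    ≡⟨ sym (cong₂ _*_ (^≡Exp^ x a) (^≡Exp^ y a)) ⟩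
    x ^ a * y ^ a            ∎

  ^-comm : ∀ x a b → (x ^ a) ^ b ≡ (x ^ b) ^ a
  ^-comm x a b = trans (^-assocʳ x a b) (trans (cong (x ^_) (ℕ.*-comm a b)) (sym (^-assocʳ x b a)))

  1^n≡1 : ∀ k → 1# ^ k ≡ 1#
  1^n≡1 zero    = refl
  1^n≡1 (suc k) = trans (*-identityˡ _) (1^n≡1 k)

  0^n≡0 : ∀ {k} → 1 ≤ k → 0# ^ k ≡ 0#
  0^n≡0 (s≤s _) = zeroˡ _

  x^n≢0 : ∀ {x} k → x ≢ 0# → x ^ k ≢ 0#
  x^n≢0 zero    _   = 1≢0
  x^n≢0 (suc k) x≢0 = x*y≢0 x≢0 (x^n≢0 k x≢0)

  x^n≡0⇒x≡0 : ∀ {x} k → x ^ k ≡ 0# → x ≡ 0#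
  x^n≡0⇒x≡0 {x} k x^k≡0 with x ≟ 0#
  ... | yes x≡0 = x≡0
  ... | no  x≢0 = ⊥-elim (x^n≢0 k x≢0 x^k≡0)

  x^n*[x⁻¹]^n≡1 : ∀ {x} k → x ≢ 0# → x ^ k * inv x ^ k ≡ 1#
  x^n*[x⁻¹]^n≡1 {x} k x≢0 = trans (sym (^-distrib-* x (inv x) k)) (trans (cong (_^ k) (inv-r x x≢0)) (1^n≡1 k))

  ^-multiple : ∀ {c K j} → c ^ K ≡ 1# → K ℕ∣.∣ j → c ^ j ≡ 1#
  ^-multiple {c} {K} c^K≡1 (divides i refl) =
    trans (cong (c ^_) (ℕ.*-comm i K)) (trans (sym (^-assocʳ c K i)) (trans (cong (_^ i) c^K≡1) (1^n≡1 i)))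

  μ-^ : ∀ {c} k j → μ k c → μ k (c ^ j)
  μ-^ {c} k j c∈μ = trans (^-comm c j k) (trans (cong (_^ j) c∈μ) (1^n≡1 j))

  μ⇒≢0 : ∀ {c} k → μ (suc k) c → c ≢ 0#
  μ⇒≢0 k c^k+1≡1 c≡0 = 0≢1 (trans (sym (zeroˡ _)) (trans (cong (λ x → x ^ suc k) (sym c≡0)) c^k+1≡1))

  order-coprime : ∀ {w a b} → w ^ a ≡ 1# → w ^ b ≡ 1# → Coprime a b → w ≡ 1#
  order-coprime {w} w^a≡1 w^b≡1 a⊥b =
    trans (sym (*-identityʳ w)) (coprime-closure (λ k → w ^ k ≡ 1#) multiple difference a⊥b w^a≡1 w^b≡1)
    where
    multiple : ∀ x a → w ^ a ≡ 1# → w ^ (x ℕ.* a) ≡ 1#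
    multiple x a w^a≡1 = ^-multiple w^a≡1 (ℕ∣.n∣m*n x)
    difference : ∀ u v → w ^ (u ℕ.+ v) ≡ 1# → w ^ v ≡ 1# → w ^ u ≡ 1#
    difference u v w^[u+v]≡1 w^v≡1 = begin
      w ^ u           ≡⟨ sym (*-identityʳ _) ⟩
      w ^ u * 1#      ≡⟨ cong (w ^ u *_) (sym w^v≡1) ⟩
      w ^ u * w ^ v   ≡⟨ sym (^-homo-* w u v) ⟩
      w ^ (u ℕ.+ v)   ≡⟨ w^[u+v]≡1 ⟩
      1#              ∎

  ^-injective-coprime : ∀ {x y a b} → x ≢ 0# → x ^ a ≡ y ^ a → x ^ b ≡ y ^ b → Coprime a b → x ≡ y
  ^-injective-coprime {x} {y} {a} {b} x≢0 x^a≡y^a x^b≡y^b a⊥b = sym (begin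
    y                  ≡⟨ sym (*-identityʳ y) ⟩
    y * 1#             ≡⟨ cong (y *_) (sym (inv-l x x≢0)) ⟩
    y * (inv x * x)    ≡⟨ sym (*-assoc y (inv x) x) ⟩
    (y * inv x) * x    ≡⟨ cong (_* x) (order-coprime (quotient^≡1 a x^a≡y^a) (quotient^≡1 b x^b≡y^b) a⊥b) ⟩
    1# * x             ≡⟨ *-identityˡ x ⟩
    x                  ∎)
    where
    quotient^≡1 : ∀ k → x ^ k ≡ y ^ k → (y * inv x) ^ k ≡ 1#
    quotient^≡1 k x^k≡y^k = begin
      (y * inv x) ^ k       ≡⟨ ^-distrib-* y (inv x) k ⟩
      y ^ k * inv x ^ k     ≡⟨ cong (_* inv x ^ k) (sym x^k≡y^k) ⟩
      x ^ k * inv x ^ k     ≡⟨ x^n*[x⁻¹]^n≡1 k x≢0 ⟩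
      1#                    ∎

  -- Fermat, characteristic and Frobenius

  module Prod = CommutativeMonoidSum *-commutativeMonoid
  module Sum  = CommutativeMonoidSum +-commutativeMonoid
  open SemiringMult semiring public using () renaming (_×_ to _×ₙ_)
  module Mult = SemiringMult semiring
  module Binomial = CommutativeSemiringBinomial commutativeSemiring

  ∏ : ∀ {k} → (Fin k → Carrier) → Carrier
  ∏ = Prod.sum

  ∑ : ∀ {k} → (Fin k → Carrier) → Carrier
  ∑ = Sum.sum

  reindex : (f g : Carrier → Carrier) → (∀ x → f (g x) ≡ x) → (∀ x → g (f x) ≡ x) → Permutation n n
  reindex f g fg gf = permutation (λ i → index (f (element i))) (λ j → index (g (element j))) (cancel f g fg) (cancel g f gf)
    where
    cancel : ∀ f g → (∀ x → f (g x) ≡ x) → ∀ j → index (f (element (index (g (element j))))) ≡ j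
    cancel f g fg j = begin
      index (f (element (index (g (element j)))))  ≡⟨ cong (index ∘ f) (element-index (g (element j))) ⟩
      index (f (g (element j)))                    ≡⟨ cong index (fg (element j)) ⟩
      index (element j)                            ≡⟨ index-element j ⟩
      j                                            ∎

  ∏≢0 : ∀ {k} (f : Fin k → Carrier) → (∀ i → f i ≢ 0#) → ∏ f ≢ 0#
  ∏≢0 {zero}  f f≢0 = 1≢0
  ∏≢0 {suc k} f f≢0 = x*y≢0 (f≢0 Fin.zero) (∏≢0 (f ∘ Fin.suc) (f≢0 ∘ Fin.suc))

  -- Multiplication by a permutes the field. The products run over all of Fin n: u replaces 0 by 1,
  -- and s x is the factor by which u changes, u (a x) = s x · u x.
  fermat : ∀ {m} → n ≡ suc m → ∀ {a} → a ≢ 0# → a ^ m ≡ 1#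
  fermat {m} refl {a} a≢0 = *-cancelʳ (∏≢0 (u ∘ element) (λ i → u≢0 (element i))) (begin
    a ^ m * ∏ (u ∘ element)                          ≡⟨ cong (_* ∏ (u ∘ element)) (sym ∏s≡a^m) ⟩
    ∏ (s ∘ element) * ∏ (u ∘ element)                ≡⟨ sym (Prod.∑-distrib-+ (s ∘ element) (u ∘ element)) ⟩
    ∏ (λ i → s (element i) * u (element i))          ≡⟨ Prod.sum-cong-≗ (λ i → sym (u[ax]≡s[x]*u[x] (element i))) ⟩
    ∏ (λ i → u (a * element i))                      ≡⟨ Prod.sum-cong-≗ (λ i → cong u (sym (element-index (a * element i)))) ⟩
    ∏ (λ i → u (element (scaling ⟨$⟩ʳ i)))           ≡⟨ sym (Prod.sum-permute (u ∘ element) scaling) ⟩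
    ∏ (u ∘ element)                                  ≡⟨ sym (*-identityˡ _) ⟩
    1# * ∏ (u ∘ element)                             ∎)
    where
    u s : Carrier → Carrier
    u x with x ≟ 0#
    ... | yes _ = 1#
    ... | no  _ = x
    s x with x ≟ 0#
    ... | yes _ = 1#
    ... | no  _ = a

    u≢0 : ∀ x → u x ≢ 0#
    u≢0 x with x ≟ 0#
    ... | yes _   = 1≢0
    ... | no  x≢0 = x≢0

    u[ax]≡s[x]*u[x] : ∀ x → u (a * x) ≡ s x * u x
    u[ax]≡s[x]*u[x] x with x ≟ 0# | a * x ≟ 0#
    ... | yes _   | yes _    = sym (*-identityˡ 1#)
    ... | yes x≡0 | no ax≢0  = ⊥-elim (ax≢0 (trans (cong (a *_) x≡0) (zeroʳ a)))
    ... | no  x≢0 | yes ax≡0 = ⊥-elim (x*y≢0 a≢0 x≢0 ax≡0)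
    ... | no  _   | no  _    = refl

    scaling : Permutation (suc m) (suc m)
    scaling = reindex (a *_) (inv a *_) (λ x → scale-cancel (inv-r a a≢0)) (λ x → scale-cancel (inv-l a a≢0))
      where
      scale-cancel : ∀ {b c x} → b * c ≡ 1# → b * (c * x) ≡ x
      scale-cancel {b} {c} {x} bc≡1 = trans (sym (*-assoc b c x)) (trans (cong (_* x) bc≡1) (*-identityˡ x))

    z : Fin (suc m)
    z = index 0#

    ∏s≡a^m : ∏ (s ∘ element) ≡ a ^ m
    ∏s≡a^m = begin
      ∏ (s ∘ element)                                  ≡⟨ Prod.sum-remove {i = z} (s ∘ element) ⟩
      s (element z) * ∏ (λ j → s (element (punchIn z j))) ≡⟨ cong₂ _*_ s[0]≡1 (Prod.sum-cong-≗ s[j]≡a) ⟩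
      1# * ∏ {m} (λ _ → a)                             ≡⟨ *-identityˡ _ ⟩
      ∏ {m} (λ _ → a)                                  ≡⟨ Prod.sum-replicate m ⟩
      a Exp.^ m                                        ≡⟨ sym (^≡Exp^ a m) ⟩
      a ^ m                                            ∎
      where
      s[0]≡1 : s (element z) ≡ 1#
      s[0]≡1 with element z ≟ 0#
      ... | yes _  = refl
      ... | no ≢0 = ⊥-elim (≢0 (element-index 0#))
      s[j]≡a : ∀ j → s (element (punchIn z j)) ≡ a
      s[j]≡a j with element (punchIn z j) ≟ 0#
      ... | yes ≡0 = ⊥-elim (Fin.punchInᵢ≢i z j (trans (sym (index-element _)) (cong index ≡0)))
      ... | no  _  = refl

  -- Translation by x permutes the field, so ∑ y + n·x = ∑ (y + x) = ∑ y.
  n×ₙx≡0 : ∀ x → n ×ₙ x ≡ 0#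
  n×ₙx≡0 x = +-identityʳ-unique (∑ element) (n ×ₙ x) (begin
    ∑ element + n ×ₙ x                   ≡⟨ cong (∑ element +_) (sym (Sum.sum-replicate n)) ⟩
    ∑ element + ∑ {n} (λ _ → x)          ≡⟨ sym (Sum.∑-distrib-+ element (λ _ → x)) ⟩
    ∑ (λ i → element i + x)              ≡⟨ Sum.sum-cong-≗ (λ i → sym (element-index (element i + x))) ⟩
    ∑ (λ i → element (translation ⟨$⟩ʳ i)) ≡⟨ sym (Sum.sum-permute element translation) ⟩
    ∑ element                            ∎)
    where
    translation : Permutation n n
    translation = reindex (_+ x) (_+ - x) (shift-cancel (-‿inverseˡ x)) (shift-cancel (-‿inverseʳ x))
      where
      shift-cancel : ∀ {b c} → c + b ≡ 0# → ∀ y → (y + c) + b ≡ y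
      shift-cancel {b} {c} c+b≡0 y = trans (+-assoc y c b) (trans (cong (y +_) c+b≡0) (+-identityʳ y))

  p^k×ₙ1≡[p×ₙ1]^k : ∀ p k → (p ℕ.^ k) ×ₙ 1# ≡ (p ×ₙ 1#) ^ k
  p^k×ₙ1≡[p×ₙ1]^k p zero    = +-identityʳ 1#
  p^k×ₙ1≡[p×ₙ1]^k p (suc k) = trans (Mult.×1-homo-* p (p ℕ.^ k)) (cong ((p ×ₙ 1#) *_) (p^k×ₙ1≡[p×ₙ1]^k p k))

  characteristic : ∀ p k → n ≡ p ℕ.^ k → p ×ₙ 1# ≡ 0#
  characteristic p k n≡p^k = x^n≡0⇒x≡0 k (begin
    (p ×ₙ 1#) ^ k      ≡⟨ sym (p^k×ₙ1≡[p×ₙ1]^k p k) ⟩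
    (p ℕ.^ k) ×ₙ 1#    ≡⟨ cong (_×ₙ 1#) (sym n≡p^k) ⟩
    n ×ₙ 1#            ≡⟨ n×ₙx≡0 1# ⟩
    0#                 ∎)

  module Frobenius {p} (p-prime : Prime p) (p×ₙ1≡0 : p ×ₙ 1# ≡ 0#) where

    p×ₙx≡0 : ∀ x → p ×ₙ x ≡ 0#
    p×ₙx≡0 x = begin
      p ×ₙ x           ≡⟨ cong (p ×ₙ_) (sym (*-identityˡ x)) ⟩
      p ×ₙ (1# * x)    ≡⟨ sym (Mult.×-assoc-* p 1# x) ⟩
      (p ×ₙ 1#) * x    ≡⟨ cong (_* x) p×ₙ1≡0 ⟩
      0# * x           ≡⟨ zeroˡ x ⟩
      0#               ∎

    binomialTerm≡0 : ∀ x y (i : Fin p) → suc (Fin.toℕ i) < p → Binomial.binomialTerm x y p (Fin.suc i) ≡ 0#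
    binomialTerm≡0 x y i 1+i<p with prime∣C p-prime (s≤s z≤n) 1+i<p
    ... | divides j C≡j*p = begin
      (p C suc (Fin.toℕ i)) ×ₙ b   ≡⟨ cong (_×ₙ b) (trans C≡j*p (ℕ.*-comm j p)) ⟩
      (p ℕ.* j) ×ₙ b               ≡⟨ sym (Mult.×-assocˡ b p j) ⟩
      p ×ₙ (j ×ₙ b)                ≡⟨ p×ₙx≡0 (j ×ₙ b) ⟩
      0#                           ∎
      where
      b : Carrier
      b = Binomial.binomial x y p (Fin.suc i)

    frobenius : ∀ x y → (x + y) ^ p ≡ x ^ p + y ^ p
    frobenius x y = frobenius′ (ℕ.suc-pred p {{prime⇒nonZero p-prime}})
      where
      frobenius′ : ∀ {m} → suc m ≡ p → (x + y) ^ p ≡ x ^ p + y ^ p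
      frobenius′ {m} refl = begin
        (x + y) ^ p                                       ≡⟨ ^≡Exp^ (x + y) p ⟩
        (x + y) Exp.^ p                                   ≡⟨ Binomial.theorem p x y ⟩
        ∑ term                                            ≡⟨ Sum.sum-init-last term ⟩
        (term Fin.zero + ∑ middle) + term (Fin.fromℕ p)   ≡⟨ cong₂ (λ a b → (term Fin.zero + a) + b) ∑middle≡0 last≡x^p ⟩
        (term Fin.zero + 0#) + x ^ p                      ≡⟨ cong (_+ x ^ p) first≡y^p ⟩
        y ^ p + x ^ p                                     ≡⟨ +-comm (y ^ p) (x ^ p) ⟩
        x ^ p + y ^ p                                     ∎
        where
        term : Fin (suc p) → Carrier
        term = Binomial.binomialTerm x y p
        middle : Fin m → Carrier
        middle j = term (Fin.suc (Fin.inject₁ j))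
        ∑middle≡0 : ∑ middle ≡ 0#
        ∑middle≡0 = trans (Sum.sum-cong-≗ middle≡0) (Sum.sum-replicate-zero m)
          where
          middle≡0 : ∀ j → middle j ≡ 0#
          middle≡0 j = binomialTerm≡0 x y (Fin.inject₁ j)
            (s≤s (subst (_< m) (sym (Fin.toℕ-inject₁ j)) (Fin.toℕ<n j)))
        first≡y^p : term Fin.zero + 0# ≡ y ^ p
        first≡y^p = trans (+-identityʳ _) (trans (+-identityʳ _) (trans (*-identityˡ _) (sym (^≡Exp^ y p))))
        last≡x^p : term (Fin.fromℕ p) ≡ x ^ p
        last≡x^p = begin
          term (Fin.fromℕ p)
            ≡⟨ cong (λ k → (p C k) ×ₙ (x Exp.^ k * y Exp.^ (p ∸ k))) (Fin.toℕ-fromℕ p) ⟩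
          (p C p) ×ₙ (x Exp.^ p * y Exp.^ (p ∸ p))
            ≡⟨ cong₂ (λ c k → c ×ₙ (x Exp.^ p * y Exp.^ k)) (nCn≡1 p) (ℕ.n∸n≡0 p) ⟩
          x Exp.^ p * 1# + 0#
            ≡⟨ trans (+-identityʳ _) (*-identityʳ _) ⟩
          x Exp.^ p
            ≡⟨ sym (^≡Exp^ x p) ⟩
          x ^ p
            ∎

    frobenius-^ : ∀ k x y → (x + y) ^ (p ℕ.^ k) ≡ x ^ (p ℕ.^ k) + y ^ (p ℕ.^ k)
    frobenius-^ zero    x y = trans (*-identityʳ _) (sym (cong₂ _+_ (*-identityʳ x) (*-identityʳ y)))
    frobenius-^ (suc k) x y = begin
      (x + y) ^ (p ℕ.* p ℕ.^ k)                      ≡⟨ sym (^-assocʳ (x + y) p (p ℕ.^ k)) ⟩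
      ((x + y) ^ p) ^ (p ℕ.^ k)                      ≡⟨ cong (_^ (p ℕ.^ k)) (frobenius x y) ⟩
      (x ^ p + y ^ p) ^ (p ℕ.^ k)                    ≡⟨ frobenius-^ k (x ^ p) (y ^ p) ⟩
      (x ^ p) ^ (p ℕ.^ k) + (y ^ p) ^ (p ℕ.^ k)      ≡⟨ cong₂ _+_ (^-assocʳ x p (p ℕ.^ k)) (^-assocʳ y p (p ℕ.^ k)) ⟩
      x ^ (p ℕ.* p ℕ.^ k) + y ^ (p ℕ.* p ℕ.^ k)      ∎

  ×ₙ1≢0 : ∀ {p k} → p ×ₙ 1# ≡ 0# → Coprime k p → k ×ₙ 1# ≢ 0#
  ×ₙ1≢0 p×ₙ1≡0 k⊥p k×ₙ1≡0 =
    1≢0 (trans (sym (+-identityʳ 1#)) (coprime-closure (λ k → k ×ₙ 1# ≡ 0#) multiple difference k⊥p k×ₙ1≡0 p×ₙ1≡0))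
    where
    multiple : ∀ x a → a ×ₙ 1# ≡ 0# → (x ℕ.* a) ×ₙ 1# ≡ 0#
    multiple x a a×ₙ1≡0 = trans (Mult.×1-homo-* x a) (trans (cong ((x ×ₙ 1#) *_) a×ₙ1≡0) (zeroʳ _))
    difference : ∀ u v → (u ℕ.+ v) ×ₙ 1# ≡ 0# → v ×ₙ 1# ≡ 0# → u ×ₙ 1# ≡ 0#
    difference u v [u+v]×ₙ1≡0 v×ₙ1≡0 = begin
      u ×ₙ 1#                ≡⟨ sym (+-identityʳ _) ⟩
      u ×ₙ 1# + 0#           ≡⟨ cong (u ×ₙ 1# +_) (sym v×ₙ1≡0) ⟩
      u ×ₙ 1# + v ×ₙ 1#      ≡⟨ sym (Mult.×-homo-+ 1# u v) ⟩
      (u ℕ.+ v) ×ₙ 1#        ≡⟨ [u+v]×ₙ1≡0 ⟩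
      0#                     ∎

  -- Polynomials and geometric sums

  module Solver = NaturalCoefficientsSolver commutativeSemiring

  eval-+ₚ : ∀ f g x → eval (f +ₚ g) x ≡ eval f x + eval g x
  eval-+ₚ []      g       x = sym (+-identityˡ _)
  eval-+ₚ (a ∷ f) []      x = sym (+-identityʳ _)
  eval-+ₚ (a ∷ f) (b ∷ g) x = begin
    (a + b) + x * eval (f +ₚ g) x              ≡⟨ cong (λ e → (a + b) + x * e) (eval-+ₚ f g x) ⟩
    (a + b) + x * (eval f x + eval g x)        ≡⟨ solve 5 (λ a b x u v → (a :+ b) :+ x :* (u :+ v) := (a :+ x :* u) :+ (b :+ x :* v))
                                                     refl a b x (eval f x) (eval g x) ⟩
    (a + x * eval f x) + (b + x * eval g x)    ∎
    where open Solver

  eval-map-* : ∀ a g x → eval (List.map (a *_) g) x ≡ a * eval g x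
  eval-map-* a []      x = sym (zeroʳ a)
  eval-map-* a (b ∷ g) x = begin
    a * b + x * eval (List.map (a *_) g) x   ≡⟨ cong (λ e → a * b + x * e) (eval-map-* a g x) ⟩
    a * b + x * (a * eval g x)               ≡⟨ cong (a * b +_) (x∙yz≈y∙xz x a (eval g x)) ⟩
    a * b + a * (x * eval g x)               ≡⟨ sym (distribˡ a b (x * eval g x)) ⟩
    a * (b + x * eval g x)                   ∎

  eval-*ₚ : ∀ f g x → eval (f *ₚ g) x ≡ eval f x * eval g x
  eval-*ₚ []      g x = sym (zeroˡ _)
  eval-*ₚ (a ∷ f) g x = begin
    eval (List.map (a *_) g +ₚ (0# ∷ (f *ₚ g))) x        ≡⟨ eval-+ₚ (List.map (a *_) g) (0# ∷ (f *ₚ g)) x ⟩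
    eval (List.map (a *_) g) x + (0# + x * eval (f *ₚ g) x) ≡⟨ cong₂ (λ u e → u + (0# + x * e)) (eval-map-* a g x) (eval-*ₚ f g x) ⟩
    a * eval g x + (0# + x * (eval f x * eval g x))      ≡⟨ solve 4 (λ a x u v → a :* v :+ (con 0 :+ x :* (u :* v)) := (a :+ x :* u) :* v)
                                                              refl a x (eval f x) (eval g x) ⟩
    (a + x * eval f x) * eval g x                        ∎
    where open Solver

  eval-monomial : ∀ k x → eval (monomial k) x ≡ x ^ k
  eval-monomial zero    x = trans (cong (1# +_) (zeroʳ x)) (+-identityʳ 1#)
  eval-monomial (suc k) x = trans (+-identityˡ _) (cong (x *_) (eval-monomial k x))

  eval-0 : ∀ g x → (∀ k → coeff g k ≡ 0#) → eval g x ≡ 0#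
  eval-0 []      x _      = refl
  eval-0 (b ∷ g) x g≈0 = begin
    b + x * eval g x    ≡⟨ cong₂ (λ u e → u + x * e) (g≈0 zero) (eval-0 g x (g≈0 ∘ suc)) ⟩
    0# + x * 0#         ≡⟨ trans (+-identityˡ _) (zeroʳ x) ⟩
    0#                  ∎

  eval-cong : ∀ f g → f ≈ₚ g → ∀ x → eval f x ≡ eval g x
  eval-cong []      g       f≈g x = sym (eval-0 g x (sym ∘ f≈g))
  eval-cong (a ∷ f) []      f≈g x = eval-0 (a ∷ f) x f≈g
  eval-cong (a ∷ f) (b ∷ g) f≈g x = cong₂ (λ u e → u + x * e) (f≈g zero) (eval-cong f g (f≈g ∘ suc) x)

  geometricSum : Carrier → ℕ → Carrier
  geometricSum w zero    = 0#
  geometricSum w (suc k) = 1# + w * geometricSum w k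

  powerSum : Carrier → (ℕ → ℕ) → ℕ → Carrier
  powerSum w f zero    = 0#
  powerSum w f (suc k) = w ^ f 0 + powerSum w (f ∘ suc) k

  powerSum-suc : ∀ w f k → powerSum w (suc ∘ f) k ≡ w * powerSum w f k
  powerSum-suc w f zero    = sym (zeroʳ w)
  powerSum-suc w f (suc k) = trans (cong (w * w ^ f 0 +_) (powerSum-suc w (f ∘ suc) k)) (sym (distribˡ w _ _))

  powerSum-id : ∀ w k → powerSum w id k ≡ geometricSum w k
  powerSum-id w zero    = refl
  powerSum-id w (suc k) = cong (1# +_) (trans (powerSum-suc w id k) (cong (w *_) (powerSum-id w k)))

  eval-monomialSum : ∀ t f k x →
    eval (List.foldr (λ j acc → monomial (j ℕ.* t) +ₚ acc) [] (List.applyUpTo f k)) x ≡ powerSum (x ^ t) f k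
  eval-monomialSum t f zero    x = refl
  eval-monomialSum t f (suc k) x = begin
    eval (monomial (f 0 ℕ.* t) +ₚ rest) x            ≡⟨ eval-+ₚ (monomial (f 0 ℕ.* t)) rest x ⟩
    eval (monomial (f 0 ℕ.* t)) x + eval rest x      ≡⟨ cong₂ _+_ (eval-monomial (f 0 ℕ.* t) x) (eval-monomialSum t (f ∘ suc) k x) ⟩
    x ^ (f 0 ℕ.* t) + powerSum (x ^ t) (f ∘ suc) k   ≡⟨ cong (λ e → x ^ e + powerSum (x ^ t) (f ∘ suc) k) (ℕ.*-comm (f 0) t) ⟩
    x ^ (t ℕ.* f 0) + powerSum (x ^ t) (f ∘ suc) k   ≡⟨ cong (_+ powerSum (x ^ t) (f ∘ suc) k) (sym (^-assocʳ x t (f 0))) ⟩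
    (x ^ t) ^ f 0 + powerSum (x ^ t) (f ∘ suc) k     ∎
    where
    rest : Poly
    rest = List.foldr (λ j acc → monomial (j ℕ.* t) +ₚ acc) [] (List.applyUpTo (f ∘ suc) k)

  eval-geomPoly : ∀ s t x → eval (geomPoly s t) x ≡ geometricSum (x ^ t) (suc s)
  eval-geomPoly s t x = trans (eval-monomialSum t id (suc s) x) (powerSum-id (x ^ t) (suc s))

  eval-prodGeom : ∀ m s t x → eval (prodGeom m s t) x ≡ ∏ (λ i → geometricSum (x ^ t i) (suc (s i)))
  eval-prodGeom zero    s t x = trans (cong (1# +_) (zeroʳ x)) (+-identityʳ 1#)
  eval-prodGeom (suc m) s t x = begin
    eval (geomPoly (s Fin.zero) (t Fin.zero) *ₚ prodGeom m (s ∘ Fin.suc) (t ∘ Fin.suc)) x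
      ≡⟨ eval-*ₚ (geomPoly (s Fin.zero) (t Fin.zero)) (prodGeom m (s ∘ Fin.suc) (t ∘ Fin.suc)) x ⟩
    eval (geomPoly (s Fin.zero) (t Fin.zero)) x * eval (prodGeom m (s ∘ Fin.suc) (t ∘ Fin.suc)) x
      ≡⟨ cong₂ _*_ (eval-geomPoly (s Fin.zero) (t Fin.zero) x) (eval-prodGeom m (s ∘ Fin.suc) (t ∘ Fin.suc) x) ⟩
    ∏ (λ i → geometricSum (x ^ t i) (suc (s i)))
      ∎

  geometricSum-sucʳ : ∀ w k → w ^ k + geometricSum w k ≡ geometricSum w (suc k)
  geometricSum-sucʳ w zero    = trans (+-identityʳ 1#) (sym (trans (cong (1# +_) (zeroʳ w)) (+-identityʳ 1#)))
  geometricSum-sucʳ w (suc k) = begin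
    w * w ^ k + (1# + w * geometricSum w k)  ≡⟨ solve 3 (λ w a g → w :* a :+ (con 1 :+ w :* g) := con 1 :+ w :* (a :+ g))
                                                  refl w (w ^ k) (geometricSum w k) ⟩
    1# + w * (w ^ k + geometricSum w k)      ≡⟨ cong (λ g → 1# + w * g) (geometricSum-sucʳ w k) ⟩
    1# + w * geometricSum w (suc k)          ∎
    where open Solver

  geometricSum-1 : ∀ k → geometricSum 1# k ≡ k ×ₙ 1#
  geometricSum-1 zero    = refl
  geometricSum-1 (suc k) = cong (1# +_) (trans (*-identityˡ _) (geometricSum-1 k))

  geometricSum≡0⇒^≡1 : ∀ {w} k → geometricSum w k ≡ 0# → w ^ k ≡ 1#
  geometricSum≡0⇒^≡1 {w} k G≡0 = begin
    w ^ k                           ≡⟨ sym (+-identityʳ _) ⟩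
    w ^ k + 0#                      ≡⟨ cong (w ^ k +_) (sym G≡0) ⟩
    w ^ k + geometricSum w k        ≡⟨ geometricSum-sucʳ w k ⟩
    1# + w * geometricSum w k       ≡⟨ cong (λ g → 1# + w * g) G≡0 ⟩
    1# + w * 0#                     ≡⟨ trans (cong (1# +_) (zeroʳ w)) (+-identityʳ 1#) ⟩
    1#                              ∎

  -- A vanishing sum forces w^k = 1, hence w = 1 by coprimality, and then the sum is k·1 ≠ 0.
  geometricSum≢0 : ∀ {w k p Q} → p ×ₙ 1# ≡ 0# → Coprime k p → w ^ Q ≡ 1# → Coprime Q k → geometricSum w k ≢ 0#
  geometricSum≢0 {w} {k} p×ₙ1≡0 k⊥p w^Q≡1 Q⊥k G≡0 = ×ₙ1≢0 p×ₙ1≡0 k⊥p (begin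
    k ×ₙ 1#              ≡⟨ sym (geometricSum-1 k) ⟩
    geometricSum 1# k    ≡⟨ cong (λ u → geometricSum u k) (sym w≡1) ⟩
    geometricSum w k     ≡⟨ G≡0 ⟩
    0#                   ∎)
    where
    w≡1 : w ≡ 1#
    w≡1 = order-coprime w^Q≡1 (geometricSum≡0⇒^≡1 k G≡0) Q⊥k

  geometricSum-mirror : ∀ {w v} → v * w ≡ 1# → ∀ k → w ^ k * geometricSum v k ≡ w * geometricSum w k
  geometricSum-mirror {w} {v} vw≡1 zero    = trans (zeroʳ _) (sym (zeroʳ w))
  geometricSum-mirror {w} {v} vw≡1 (suc k) = begin
    (w * w ^ k) * (1# + v * geometricSum v k)         ≡⟨ solve 4 (λ w a v g → (w :* a) :* (con 1 :+ v :* g) := w :* a :+ (v :* w) :* (a :* g))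
                                                             refl w (w ^ k) v (geometricSum v k) ⟩
    w * w ^ k + (v * w) * (w ^ k * geometricSum v k)  ≡⟨ cong₂ (λ u g → w * w ^ k + u * g) vw≡1 (geometricSum-mirror vw≡1 k) ⟩
    w * w ^ k + 1# * (w * geometricSum w k)           ≡⟨ cong (w * w ^ k +_) (*-identityˡ _) ⟩
    w * w ^ k + w * geometricSum w k                  ≡⟨ sym (distribˡ w _ _) ⟩
    w * (w ^ k + geometricSum w k)                    ≡⟨ cong (w *_) (geometricSum-sucʳ w k) ⟩
    w * geometricSum w (suc k)                        ∎
    where open Solver

  ^-sumFin*∏^≡1 : ∀ {c e} m (a : Fin m → ℕ) (g : Fin m → Carrier) →
                  (∀ i → c ^ a i * g i ^ e ≡ 1#) → c ^ sumFin m a * ∏ g ^ e ≡ 1#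
  ^-sumFin*∏^≡1 {c} {e} zero    a g _ = trans (*-identityˡ _) (1^n≡1 e)
  ^-sumFin*∏^≡1 {c} {e} (suc m) a g each≡1 = begin
    c ^ (a Fin.zero ℕ.+ sumFin m (a ∘ Fin.suc)) * (g Fin.zero * ∏ (g ∘ Fin.suc)) ^ e
      ≡⟨ cong₂ _*_ (^-homo-* c (a Fin.zero) _) (^-distrib-* (g Fin.zero) _ e) ⟩
    (c ^ a Fin.zero * c ^ sumFin m (a ∘ Fin.suc)) * (g Fin.zero ^ e * ∏ (g ∘ Fin.suc) ^ e)
      ≡⟨ interchange _ _ _ _ ⟩
    (c ^ a Fin.zero * g Fin.zero ^ e) * (c ^ sumFin m (a ∘ Fin.suc) * ∏ (g ∘ Fin.suc) ^ e)
      ≡⟨ cong₂ _*_ (each≡1 Fin.zero) (^-sumFin*∏^≡1 {c} {e} m (a ∘ Fin.suc) (g ∘ Fin.suc) (each≡1 ∘ Fin.suc)) ⟩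
    1# * 1#
      ≡⟨ *-identityˡ 1# ⟩
    1#  ∎

  -- Permutation criterion

  injective⇒permutes : ∀ {f} → Injective _≡_ _≡_ f → Permutes f
  injective⇒permutes {f} f-inj = f-inj , surjective
    where
    surjective : Surjective _≡_ _≡_ f
    surjective y with Fin-injective⇒surjective (index ∘ f ∘ element) (element-injective ∘ f-inj ∘ index-injective) (index y)
    ... | i , fᵢ≡y = element i , λ { refl → index-injective fᵢ≡y }

  PermutesMu-cong : ∀ {k f g} → (∀ c → μ k c → f c ≡ g c) → PermutesMu k f → PermutesMu k g
  PermutesMu-cong {k} {f} {g} f≗g (f-maps , f-inj , f-onto) = g-maps , g-inj , g-onto
    where
    g-maps : ∀ c → μ k c → μ k (g c)
    g-maps c c∈μ = subst (μ k) (f≗g c c∈μ) (f-maps c c∈μ)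
    g-inj : ∀ c d → μ k c → μ k d → g c ≡ g d → c ≡ d
    g-inj c d c∈μ d∈μ gc≡gd = f-inj c d c∈μ d∈μ (trans (f≗g c c∈μ) (trans gc≡gd (sym (f≗g d d∈μ))))
    g-onto : ∀ d → μ k d → ∃ λ c → μ k c × (g c ≡ d)
    g-onto d d∈μ with f-onto d d∈μ
    ... | c , c∈μ , fc≡d = c , c∈μ , trans (sym (f≗g c c∈μ)) fc≡d

  -- x ↦ x^e maps the nonzero elements into μ and f(x)^e = g(x^e); so f x = f y pins down x^e,
  -- then x^r, and coprimality of r and e gives x = y.
  PermutesMu⇒Permutes : ∀ {e K r} → (∀ x → x ≢ 0# → μ (suc K) (x ^ suc e)) → (B : Poly) → 1 ≤ r → Coprime r (suc e) →
    PermutesMu (suc K) (λ c → c ^ r * eval B c ^ suc e) → Permutes (λ x → x ^ r * eval B (x ^ suc e))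
  PermutesMu⇒Permutes {e} {K} {r} x^e∈μ B 1≤r r⊥e (g-maps , g-inj , _) = injective⇒permutes f-inj
    where
    f g : Carrier → Carrier
    f x = x ^ r * eval B (x ^ suc e)
    g c = c ^ r * eval B c ^ suc e

    B≢0 : ∀ {z} → μ (suc K) z → eval B z ≢ 0#
    B≢0 {z} z∈μ B≡0 = μ⇒≢0 K (g-maps z z∈μ) (begin
      z ^ r * eval B z ^ suc e  ≡⟨ cong (λ b → z ^ r * b ^ suc e) B≡0 ⟩
      z ^ r * (0# * 0# ^ e)     ≡⟨ cong (z ^ r *_) (zeroˡ _) ⟩
      z ^ r * 0#                ≡⟨ zeroʳ _ ⟩
      0#                        ∎)

    f≢0 : ∀ {x} → x ≢ 0# → f x ≢ 0#
    f≢0 {x} x≢0 = x*y≢0 (x^n≢0 r x≢0) (B≢0 (x^e∈μ x x≢0))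

    f0≡0 : f 0# ≡ 0#
    f0≡0 = trans (cong (_* eval B (0# ^ suc e)) (0^n≡0 1≤r)) (zeroˡ _)

    f^e≡g[x^e] : ∀ x → f x ^ suc e ≡ g (x ^ suc e)
    f^e≡g[x^e] x = trans (^-distrib-* (x ^ r) _ (suc e)) (cong (_* eval B (x ^ suc e) ^ suc e) (^-comm x r (suc e)))

    f-inj : Injective _≡_ _≡_ f
    f-inj {x} {y} fx≡fy with x ≟ 0# | y ≟ 0#
    ... | yes x≡0 | yes y≡0 = trans x≡0 (sym y≡0)
    ... | yes x≡0 | no  y≢0 = ⊥-elim (f≢0 y≢0 (trans (sym fx≡fy) (trans (cong f x≡0) f0≡0)))
    ... | no  x≢0 | yes y≡0 = ⊥-elim (f≢0 x≢0 (trans fx≡fy (trans (cong f y≡0) f0≡0)))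
    ... | no  x≢0 | no  y≢0 = ^-injective-coprime x≢0 x^r≡y^r x^e≡y^e r⊥e
      where
      x^e≡y^e : x ^ suc e ≡ y ^ suc e
      x^e≡y^e = g-inj _ _ (x^e∈μ x x≢0) (x^e∈μ y y≢0)
                  (trans (sym (f^e≡g[x^e] x)) (trans (cong (_^ suc e) fx≡fy) (f^e≡g[x^e] y)))
      x^r≡y^r : x ^ r ≡ y ^ r
      x^r≡y^r = *-cancelʳ (B≢0 (x^e∈μ x x≢0)) (trans fx≡fy (cong (λ z → y ^ r * eval B z) (sym x^e≡y^e)))

  -- Roots of unity

  ^-≡-mod-≤ : ∀ {c K a b} → c ^ K ≡ 1# → a ≤ b → K ℕ∣.∣ b ∸ a → c ^ b ≡ c ^ a
  ^-≡-mod-≤ {c} {K} {a} {b} c^K≡1 a≤b K∣b∸a = begin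
    c ^ b                ≡⟨ cong (c ^_) (sym (ℕ.m+[n∸m]≡n a≤b)) ⟩
    c ^ (a ℕ.+ (b ∸ a))  ≡⟨ ^-homo-* c a (b ∸ a) ⟩
    c ^ a * c ^ (b ∸ a)  ≡⟨ cong (c ^ a *_) (^-multiple c^K≡1 K∣b∸a) ⟩
    c ^ a * 1#           ≡⟨ *-identityʳ _ ⟩
    c ^ a                ∎

  ^-≡-mod : ∀ {c K} a b → c ^ K ≡ 1# → (ℤ.+ K) ℤ∣.∣ (ℤ.+ a ℤ.- ℤ.+ b) → c ^ a ≡ c ^ b
  ^-≡-mod {c} {K} a b c^K≡1 K∣a-b with ℕ.≤-total b a
  ... | inj₁ b≤a = ^-≡-mod-≤ c^K≡1 b≤a (subst (K ℕ∣.∣_) (trans (cong ℤ.∣_∣ (ℤ.m-n≡m⊖n a b))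
                                          (trans (ℤ.∣m⊖n∣≡∣n⊖m∣ a b) (ℤ.∣⊖∣-≤ b≤a))) K∣a-b)
  ... | inj₂ a≤b = sym (^-≡-mod-≤ c^K≡1 a≤b (subst (K ℕ∣.∣_) (trans (cong ℤ.∣_∣ (ℤ.m-n≡m⊖n a b))
                                                (ℤ.∣⊖∣-≤ a≤b)) K∣a-b))

  ^ℤ-as-quotient : ∀ {c} → c ≢ 0# → ∀ v → Σ ℕ λ a → Σ ℕ λ b → (v ℤ.+ ℤ.+ b ≡ ℤ.+ a) × (c ^ℤ v * c ^ b ≡ c ^ a)
  ^ℤ-as-quotient     c≢0 (ℤ.+ a)      = a , 0 , ℤ.+-identityʳ (ℤ.+ a) , *-identityʳ _
  ^ℤ-as-quotient {c} c≢0 (ℤ.-[1+ k ]) =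
    0 , suc k , ℤ.+-inverseˡ (ℤ.+ suc k) , trans (*-comm _ (c ^ suc k)) (x^n*[x⁻¹]^n≡1 (suc k) c≢0)

  ^≡^ℤ*^-mod : ∀ {c K} a v b → c ≢ 0# → c ^ K ≡ 1# → (ℤ.+ K) ℤ∣.∣ (ℤ.+ a ℤ.- (v ℤ.+ ℤ.+ b)) →
               c ^ a ≡ c ^ℤ v * c ^ b
  ^≡^ℤ*^-mod {c} {K} a v b c≢0 c^K≡1 K∣a-[v+b] with ^ℤ-as-quotient c≢0 v
  ... | a′ , b′ , v+b′≡a′ , c^v*c^b′≡c^a′ = *-cancelʳ (x^n≢0 b′ c≢0) (begin
    c ^ a * c ^ b′               ≡⟨ sym (^-homo-* c a b′) ⟩
    c ^ (a ℕ.+ b′)               ≡⟨ ^-≡-mod (a ℕ.+ b′) (a′ ℕ.+ b) c^K≡1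
                                      (subst ((ℤ.+ K) ℤ∣.∣_) (sym exponents≡) K∣a-[v+b]) ⟩
    c ^ (a′ ℕ.+ b)               ≡⟨ ^-homo-* c a′ b ⟩
    c ^ a′ * c ^ b               ≡⟨ cong (_* c ^ b) (sym c^v*c^b′≡c^a′) ⟩
    (c ^ℤ v * c ^ b′) * c ^ b    ≡⟨ xy∙z≈xz∙y (c ^ℤ v) (c ^ b′) (c ^ b) ⟩
    (c ^ℤ v * c ^ b) * c ^ b′    ∎)
    where
    exponents≡ : ℤ.+ (a ℕ.+ b′) ℤ.- ℤ.+ (a′ ℕ.+ b) ≡ ℤ.+ a ℤ.- (v ℤ.+ ℤ.+ b)
    exponents≡ = begin
      ℤ.+ (a ℕ.+ b′) ℤ.- ℤ.+ (a′ ℕ.+ b)                  ≡⟨ cong₂ ℤ._-_ (ℤ.pos-+ a b′) (ℤ.pos-+ a′ b) ⟩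
      (ℤ.+ a ℤ.+ ℤ.+ b′) ℤ.- (ℤ.+ a′ ℤ.+ ℤ.+ b)          ≡⟨ cong (λ z → (ℤ.+ a ℤ.+ ℤ.+ b′) ℤ.- (z ℤ.+ ℤ.+ b))
                                                              (sym v+b′≡a′) ⟩
      (ℤ.+ a ℤ.+ ℤ.+ b′) ℤ.- ((v ℤ.+ ℤ.+ b′) ℤ.+ ℤ.+ b)  ≡⟨ solve 4 (λ a b′ v b → (a :+ b′) :- ((v :+ b′) :+ b)
                                                                                := a :- (v :+ b))
                                                              refl (ℤ.+ a) (ℤ.+ b′) v (ℤ.+ b) ⟩
      ℤ.+ a ℤ.- (v ℤ.+ ℤ.+ b)                            ∎
      where open ℤSolver.+-*-Solver

  module FrobeniusQ (q′ : ℕ) (frobenius-q : ∀ x y → (x + y) ^ suc q′ ≡ x ^ suc q′ + y ^ suc q′) where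

    geometricSum-^q : ∀ w k → geometricSum w k ^ suc q′ ≡ geometricSum (w ^ suc q′) k
    geometricSum-^q w zero    = zeroˡ _
    geometricSum-^q w (suc k) = begin
      (1# + w * geometricSum w k) ^ suc q′                 ≡⟨ frobenius-q 1# _ ⟩
      1# ^ suc q′ + (w * geometricSum w k) ^ suc q′        ≡⟨ cong₂ _+_ (1^n≡1 (suc q′)) (^-distrib-* w _ (suc q′)) ⟩
      1# + w ^ suc q′ * geometricSum w k ^ suc q′          ≡⟨ cong (λ g → 1# + w ^ suc q′ * g) (geometricSum-^q w k) ⟩
      1# + w ^ suc q′ * geometricSum (w ^ suc q′) k        ∎

    -- For w ∈ μ_{q+1}, w^q = w⁻¹, so Frobenius reverses the geometric sum: a^q = w^{-s} a.
    w^s*geometricSum^[q-1]≡1 : ∀ {w} s → μ (suc (suc q′)) w → geometricSum w (suc s) ≢ 0# →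
                                w ^ s * geometricSum w (suc s) ^ q′ ≡ 1#
    w^s*geometricSum^[q-1]≡1 {w} s w∈μ a≢0 = *-cancelˡ a≢0 (begin
      a * (w ^ s * a ^ q′)   ≡⟨ x∙yz≈y∙xz a (w ^ s) (a ^ q′) ⟩
      w ^ s * a ^ suc q′     ≡⟨ *-cancelˡ (μ⇒≢0 (suc q′) w∈μ) w*w^s*a^q≡w*a ⟩
      a                      ≡⟨ sym (*-identityʳ a) ⟩
      a * 1#                 ∎)
      where
      a : Carrier
      a = geometricSum w (suc s)
      w*w^s*a^q≡w*a : w * (w ^ s * a ^ suc q′) ≡ w * a
      w*w^s*a^q≡w*a = begin
        w * (w ^ s * a ^ suc q′)                     ≡⟨ sym (*-assoc w _ _) ⟩
        w ^ suc s * a ^ suc q′                       ≡⟨ cong (w ^ suc s *_) (geometricSum-^q w (suc s)) ⟩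
        w ^ suc s * geometricSum (w ^ suc q′) (suc s) ≡⟨ geometricSum-mirror (trans (*-comm _ w) w∈μ) (suc s) ⟩
        w * a                                        ∎

    eval-prodGeom^[q-1] : ∀ {c} m s t → μ (suc (suc q′)) c → (∀ i → geometricSum (c ^ t i) (suc (s i)) ≢ 0#) →
                          c ^ sumFin m (λ i → s i ℕ.* t i) * eval (prodGeom m s t) c ^ q′ ≡ 1#
    eval-prodGeom^[q-1] {c} m s t c∈μ factor≢0 = begin
      c ^ sumFin m (λ i → s i ℕ.* t i) * eval (prodGeom m s t) c ^ q′
        ≡⟨ cong (λ e → c ^ sumFin m (λ i → s i ℕ.* t i) * e ^ q′) (eval-prodGeom m s t c) ⟩
      c ^ sumFin m (λ i → s i ℕ.* t i) * ∏ (λ i → geometricSum (c ^ t i) (suc (s i))) ^ q′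
        ≡⟨ ^-sumFin*∏^≡1 {c} {q′} m (λ i → s i ℕ.* t i) (λ i → geometricSum (c ^ t i) (suc (s i))) factor ⟩
      1# ∎
      where
      factor : ∀ i → c ^ (s i ℕ.* t i) * geometricSum (c ^ t i) (suc (s i)) ^ q′ ≡ 1#
      factor i = trans (cong (λ e → c ^ e * geometricSum (c ^ t i) (suc (s i)) ^ q′) (ℕ.*-comm (s i) (t i)))
                (trans (cong (_* geometricSum (c ^ t i) (suc (s i)) ^ q′) (sym (^-assocʳ c (t i) (s i))))
                       (w^s*geometricSum^[q-1]≡1 (s i) (μ-^ (suc (suc q′)) (t i) c∈μ) (factor≢0 i)))

    module _ {m : ℕ} {s t : Fin m → ℕ} {c : Carrier} (c∈μ : μ (suc (suc q′)) c)
             (factor≢0 : ∀ i → geometricSum (c ^ t i) (suc (s i)) ≢ 0#) where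

      private
        S : ℕ
        S = sumFin m (λ i → s i ℕ.* t i)
        P : Poly
        P = prodGeom m s t

      *-^S*eval-*ₚ-prodGeom^[q-1] : ∀ x f → (x * c ^ S) * eval (f *ₚ P) c ^ q′ ≡ x * eval f c ^ q′
      *-^S*eval-*ₚ-prodGeom^[q-1] x f = begin
        (x * c ^ S) * eval (f *ₚ P) c ^ q′             ≡⟨ cong (λ e → (x * c ^ S) * e ^ q′) (eval-*ₚ f P c) ⟩
        (x * c ^ S) * (eval f c * eval P c) ^ q′       ≡⟨ cong ((x * c ^ S) *_) (^-distrib-* (eval f c) (eval P c) q′) ⟩
        (x * c ^ S) * (eval f c ^ q′ * eval P c ^ q′)  ≡⟨ interchange x (c ^ S) _ _ ⟩
        (x * eval f c ^ q′) * (c ^ S * eval P c ^ q′)  ≡⟨ cong ((x * eval f c ^ q′) *_) (eval-prodGeom^[q-1] m s t c∈μ factor≢0) ⟩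
        (x * eval f c ^ q′) * 1#                       ≡⟨ *-identityʳ _ ⟩
        x * eval f c ^ q′                              ∎

      ^r*[D*P]^[q-1]≡^v*D^[q-1] : ∀ r v D → (ℤ.+ suc (suc q′)) ℤ∣.∣ (ℤ.+ r ℤ.- (v ℤ.+ ℤ.+ S)) →
                                   c ^ r * eval (D *ₚ P) c ^ q′ ≡ c ^ℤ v * eval D c ^ q′
      ^r*[D*P]^[q-1]≡^v*D^[q-1] r v D K∣r-[v+S] = begin
        c ^ r * eval (D *ₚ P) c ^ q′             ≡⟨ cong (_* eval (D *ₚ P) c ^ q′) (^≡^ℤ*^-mod r v S c≢0 c∈μ K∣r-[v+S]) ⟩
        (c ^ℤ v * c ^ S) * eval (D *ₚ P) c ^ q′  ≡⟨ *-^S*eval-*ₚ-prodGeom^[q-1] (c ^ℤ v) D ⟩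
        c ^ℤ v * eval D c ^ q′                   ∎
        where
        c≢0 : c ≢ 0#
        c≢0 = μ⇒≢0 (suc q′) c∈μ

      ^r*B^[q-1]≡^v*D^[q-1] : ∀ r v B D → D ≈ₚ (B *ₚ P) → (ℤ.+ suc (suc q′)) ℤ∣.∣ (ℤ.+ r ℤ.- (v ℤ.- ℤ.+ S)) →
                               c ^ r * eval B c ^ q′ ≡ c ^ℤ v * eval D c ^ q′
      ^r*B^[q-1]≡^v*D^[q-1] r v B D D≈BP K∣r-[v-S] = sym (begin
        c ^ℤ v * eval D c ^ q′                ≡⟨ cong₂ (λ x d → x * d ^ q′) c^v≡c^r*c^S (eval-cong D (B *ₚ P) D≈BP c) ⟩
        (c ^ r * c ^ S) * eval (B *ₚ P) c ^ q′ ≡⟨ *-^S*eval-*ₚ-prodGeom^[q-1] (c ^ r) B ⟩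
        c ^ r * eval B c ^ q′                 ∎)
        where
        exponents≡ : ℤ.+ (r ℕ.+ S) ℤ.- (v ℤ.+ ℤ.+ 0) ≡ ℤ.+ r ℤ.- (v ℤ.- ℤ.+ S)
        exponents≡ = begin
          ℤ.+ (r ℕ.+ S) ℤ.- (v ℤ.+ ℤ.+ 0)     ≡⟨ cong (ℤ._- (v ℤ.+ ℤ.+ 0)) (ℤ.pos-+ r S) ⟩
          (ℤ.+ r ℤ.+ ℤ.+ S) ℤ.- (v ℤ.+ ℤ.+ 0) ≡⟨ solve 3 (λ r s v → (r :+ s) :- (v :+ con (ℤ.+ 0)) := r :- (v :- s))
                                                   refl (ℤ.+ r) (ℤ.+ S) v ⟩
          ℤ.+ r ℤ.- (v ℤ.- ℤ.+ S)             ∎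
          where open ℤSolver.+-*-Solver
        c^v≡c^r*c^S : c ^ℤ v ≡ c ^ r * c ^ S
        c^v≡c^r*c^S = begin
          c ^ℤ v              ≡⟨ sym (*-identityʳ _) ⟩
          c ^ℤ v * c ^ 0      ≡⟨ sym (^≡^ℤ*^-mod (r ℕ.+ S) v 0 (μ⇒≢0 (suc q′) c∈μ) c∈μ
                                     (subst ((ℤ.+ suc (suc q′)) ℤ∣.∣_) (sym exponents≡) K∣r-[v-S])) ⟩
          c ^ (r ℕ.+ S)       ≡⟨ ^-homo-* c r S ⟩
          c ^ r * c ^ S       ∎

module FieldOfPrimePowerSquareOrder {q″ p k : ℕ} (p-prime : Prime p) (q≡p^k : suc (suc q″) ≡ p ℕ.^ k) (1≤k : 1 ≤ k)
                                    (F : FiniteField (suc (suc q″) ℕ.* suc (suc q″))) where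

  open FiniteFieldProperties F public

  p×ₙ1≡0 : p ×ₙ 1# ≡ 0#
  p×ₙ1≡0 = characteristic p (k ℕ.+ k) (trans (cong₂ ℕ._*_ q≡p^k q≡p^k) (sym (ℕ.^-distribˡ-+-* p k k)))

  frobenius-q : ∀ x y → (x + y) ^ suc (suc q″) ≡ x ^ suc (suc q″) + y ^ suc (suc q″)
  frobenius-q x y = subst (λ e → (x + y) ^ e ≡ x ^ e + y ^ e) (sym q≡p^k) (Frobenius.frobenius-^ p-prime p×ₙ1≡0 k x y)

  open FrobeniusQ (suc q″) frobenius-q public

  x^[q-1]∈μ : ∀ x → x ≢ 0# → μ (suc (suc (suc q″))) (x ^ suc q″)
  x^[q-1]∈μ x x≢0 = trans (^-assocʳ x (suc q″) (suc (suc (suc q″)))) (fermat q²≡1+[q-1][q+1] x≢0)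
    where
    q²≡1+[q-1][q+1] : suc (suc q″) ℕ.* suc (suc q″) ≡ suc (suc q″ ℕ.* suc (suc (suc q″)))
    q²≡1+[q-1][q+1] = solve 1 (λ x → (con 2 :+ x) :* (con 2 :+ x) := con 1 :+ (con 1 :+ x) :* (con 3 :+ x)) refl q″
      where open ℕSolver.+-*-Solver

  p∣q : p ℕ∣.∣ suc (suc q″)
  p∣q = subst (p ℕ∣.∣_) (sym q≡p^k) (m∣m^n p 1≤k)

  geometricSum[c^t]≢0 : ∀ {c} s t → μ (suc (suc (suc q″))) c → Coprime (suc s) (suc (suc q″)) →
                        Coprime (quotGcd (suc (suc q″)) t) (suc s) → geometricSum (c ^ t) (suc s) ≢ 0#
  geometricSum[c^t]≢0 {c} s t c∈μ 1+s⊥q Q⊥1+s =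
    geometricSum≢0 p×ₙ1≡0 (coprime-∣ʳ 1+s⊥q p∣q) (trans (^-assocʳ c t _) (^-multiple c∈μ ([1+q]∣t*quotGcd _ t))) Q⊥1+s

-- Opened only now: with prefix +_ in scope, sections such as (y +_) above would be ambiguous.
open import Data.Integer using (ℤ; +_)

corollary3 : (q : ℕ) → IsPrimePower q → (F : FiniteField (q ℕ.* q)) →
    let open FiniteField F in
    (v : ℤ) → (D : Poly) →
    PermutesMu (suc q) (λ c → (c ^ℤ v) * (eval D c ^ (q ∸ 1))) →
    (m : ℕ) → (s t : Fin m → ℕ) →
    (∀ i → 1 ≤ s i) → (∀ i → 1 ≤ t i) →
    (∀ i → Coprime (suc (s i)) q) →
    (∀ i → Coprime (quotGcd q (t i)) (suc (s i))) →
    ((r : ℕ) → 1 ≤ r → Coprime r (q ∸ 1) →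
      (+ suc q) ∣ ((+ r) ℤ.- (v ℤ.+ (+ sumFin m (λ i → s i ℕ.* t i)))) →
      Permutes (λ c → (c ^ r) * eval (D *ₚ prodGeom m s t) (c ^ (q ∸ 1))))
    ×
    ((B : Poly) → D ≈ₚ (B *ₚ prodGeom m s t) →
      (r : ℕ) → 1 ≤ r → Coprime r (q ∸ 1) →
      (+ suc q) ∣ ((+ r) ℤ.- (v ℤ.- (+ sumFin m (λ i → s i ℕ.* t i)))) →
      Permutes (λ c → (c ^ r) * eval B (c ^ (q ∸ 1))))
corollary3 zero          q-pp = contradiction (primePower≥2 q-pp) λ ()
corollary3 (suc zero)    q-pp = contradiction (primePower≥2 q-pp) λ { (s≤s ()) }
corollary3 (suc (suc q″)) (p , k , p-prime , 1≤k , q≡p^k) F v D D-perm m s t _ _ 1+s⊥q Q⊥1+s =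
    (λ r 1≤r r⊥q-1 K∣r-[v+S] → permutes (D *ₚ prodGeom m s t) 1≤r r⊥q-1
       (λ c c∈μ → ^r*[D*P]^[q-1]≡^v*D^[q-1] c∈μ (factor≢0 c∈μ) r v D K∣r-[v+S]))
  , (λ B D≈BP r 1≤r r⊥q-1 K∣r-[v-S] → permutes B 1≤r r⊥q-1
       (λ c c∈μ → ^r*B^[q-1]≡^v*D^[q-1] c∈μ (factor≢0 c∈μ) r v B D D≈BP K∣r-[v-S]))
  where
  open FieldOfPrimePowerSquareOrder p-prime q≡p^k 1≤k F

  factor≢0 : ∀ {c} → μ (suc (suc (suc q″))) c → ∀ i → geometricSum (c ^ t i) (suc (s i)) ≢ 0#
  factor≢0 c∈μ i = geometricSum[c^t]≢0 (s i) (t i) c∈μ (1+s⊥q i) (Q⊥1+s i)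

  permutes : ∀ {r} B → 1 ≤ r → Coprime r (suc q″) →
             (∀ c → μ (suc (suc (suc q″))) c → c ^ r * eval B c ^ suc q″ ≡ c ^ℤ v * eval D c ^ suc q″) →
             Permutes (λ x → x ^ r * eval B (x ^ suc q″))
  permutes B 1≤r r⊥q-1 agree-on-μ = PermutesMu⇒Permutes {K = suc (suc q″)} x^[q-1]∈μ B 1≤r r⊥q-1
    (PermutesMu-cong {k = suc (suc (suc q″))} (λ c c∈μ → sym (agree-on-μ c c∈μ)) D-perm)
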